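{- Let $\mathcal{G}$ be a proper acyclic $q$-colouring of a graph $G$. Then for every two distinct edges $K_1,K_2$ of $\mathcal{C}(\mathcal{G})$ we have $|K_1\cap K_2|\le 1$ and $\nu_G(K_1,K_2)\le 1$.
   Context: A $q$-colouring of $G=(V,E)$ is a sequence $\mathcal{G}=(G_0,G_1,\dots,G_q)$ of simple graphs $G_j=(V,E_j)$ with $\bigcup_{j=0}^qE_j=E$. It is $S$-proper ($S\subseteq V$) if $E_0$ equals the set of edges of $G$ with an endpoint in $S$ and $E_0$ is disjoint from $E_1,\dots,E_q$; it is proper if it is $S$-proper for some $S\subseteq V$. $\mathcal{C}(\mathcal{G})$ is the multi-hypergraph on $V$ whose edges are the vertex sets of all connected components of $G_1,\dots,G_q$ (one edge per component per colour). For a hypergraph, its incidence graph is the bipartite graph between vertices and edges joining $u$ to $S$ iff $u\in S$; a hypergraph is a hyperforest if its incidence graph has no cycles; $\mathcal{G}$ is acyclic if $\mathcal{C}(\mathcal{G})$ is a hyperforest. For $X,Y\subseteq V$, $\nu_G(X,Y)$ is the maximum size of a matching in $G$ each of whose edges has one endpoint in $X$ and the other in $Y$. -}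

module Defs where

open import Data.Nat using (ℕ; zero; suc; _≤_)
open import Data.Fin using (Fin; zero; suc; inject₁; fromℕ)
open import Data.Fin.Subset using (Subset; _∈_)
open import Data.Product using (Σ; ∃; ∃-syntax; _×_; _,_; proj₁; proj₂)
open import Data.Sum using (_⊎_)
open import Data.List using (List; []; _∷_; concatMap; length)
open import Data.List.Relation.Unary.All using (All)
open import Data.List.Relation.Unary.Unique.Propositional using (Unique)
open import Relation.Nullary using (¬_)
open import Relation.Binary.PropositionalEquality using (_≡_; _≢_)
open import Relation.Binary.Construct.Closure.ReflexiveTransitive using (Star)
open import Function.Definitions using (Injective)

record SimpleGraph (n : ℕ) : Set₁ where
  field
    Adj   : Fin n → Fin n → Set
    sym   : ∀ {u v} → Adj u v → Adj v u
    irrefl : ∀ {u} → ¬ Adj u u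
open SimpleGraph public

-- A q-colouring of G: a sequence (G_0, …, G_q) of simple graphs on the same vertex
-- set, whose edge sets have union E(G).
-- Colour 0 is index zero, colour j ≥ 1 is index (suc j') with j' : Fin q.
Colouring : ℕ → ℕ → Set₁
Colouring n q = Fin (suc q) → SimpleGraph n

IsColouring : {n q : ℕ} (G : SimpleGraph n) → Colouring n q → Set
IsColouring {n} {q} G 𝒢 =
  ∀ (u v : Fin n) →
    (Adj G u v → ∃[ j ] Adj (𝒢 j) u v) × (∀ j → Adj (𝒢 j) u v → Adj G u v)

SProper : {n q : ℕ} (G : SimpleGraph n) → Colouring n q → Subset n → Set
SProper {n} {q} G 𝒢 S =
  (∀ (u v : Fin n) →
     (Adj (𝒢 zero) u v → Adj G u v × (u ∈ S ⊎ v ∈ S)) ×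
     (Adj G u v × (u ∈ S ⊎ v ∈ S) → Adj (𝒢 zero) u v)) ×
  (∀ (j : Fin q) (u v : Fin n) → Adj (𝒢 zero) u v → ¬ Adj (𝒢 (suc j)) u v)

Proper : {n q : ℕ} (G : SimpleGraph n) → Colouring n q → Set
Proper {n} G 𝒢 = ∃[ S ] SProper G 𝒢 S

IsComponent : {n : ℕ} → SimpleGraph n → Subset n → Set
IsComponent {n} H K =
  ∃[ v ] (∀ (u : Fin n) → (u ∈ K → Star (Adj H) v u) × (Star (Adj H) v u → u ∈ K))

-- Edges of the multi-hypergraph C(𝒢): one per colour j ∈ {1..q} and per component
-- of G_j.  An edge is a triple (colour, vertex set, proof it is a component).
CEdge : {n q : ℕ} → Colouring n q → Set
CEdge {n} {q} 𝒢 = Σ (Fin q) λ j → Σ (Subset n) λ K → IsComponent (𝒢 (suc j)) K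

key : {n q : ℕ} (𝒢 : Colouring n q) → CEdge 𝒢 → Fin q × Subset n
key _ (j , K , _) = j , K

verts : {n q : ℕ} (𝒢 : Colouring n q) → CEdge 𝒢 → Subset n
verts _ (_ , K , _) = K

-- A cycle in the incidence graph of C(𝒢): v_0 K_0 v_1 K_1 … v_m K_m v_0 with
-- m ≥ 1, the v_i pairwise distinct, the K_i pairwise distinct edges,
-- v_i ∈ K_i and v_{i+1} ∈ K_i (indices mod m+1).
record IncidenceCycle {n q : ℕ} (𝒢 : Colouring n q) : Set where
  field
    m      : ℕ
    m≥1    : 1 ≤ m
    vs     : Fin (suc m) → Fin n
    Ks     : Fin (suc m) → CEdge 𝒢
    vs-inj : Injective _≡_ _≡_ vs
    Ks-inj : ∀ i j → key 𝒢 (Ks i) ≡ key 𝒢 (Ks j) → i ≡ j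
    inc₁   : ∀ i → vs i ∈ verts 𝒢 (Ks i)
    inc₂   : ∀ (i : Fin m) → vs (suc i) ∈ verts 𝒢 (Ks (inject₁ i))
    close  : vs zero ∈ verts 𝒢 (Ks (fromℕ m))

Acyclic : {n q : ℕ} → Colouring n q → Set
Acyclic 𝒢 = ¬ IncidenceCycle 𝒢

endpoints : {n : ℕ} → List (Fin n × Fin n) → List (Fin n)
endpoints = concatMap (λ p → proj₁ p ∷ proj₂ p ∷ [])

IsXYMatching : {n : ℕ} → SimpleGraph n → Subset n → Subset n → List (Fin n × Fin n) → Set
IsXYMatching G X Y M =
  All (λ p → proj₁ p ∈ X × proj₂ p ∈ Y × Adj G (proj₁ p) (proj₂ p)) M × Unique (endpoints M)

ν≤ : {n : ℕ} → SimpleGraph n → Subset n → Subset n → ℕ → Set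
ν≤ G X Y k = ∀ M → IsXYMatching G X Y M → length M ≤ k

{-# OPTIONS --safe #-}
-- Two distinct hyperedges sharing two vertices a, b give the cycle a K₁ b K₂ a of the
-- incidence graph. For the matching bound, let x₁y₁ and x₂y₂ be disjoint edges of G with
-- xᵢ ∈ K₁ and yᵢ ∈ K₂. A vertex of S has no edge of positive colour, so it is alone in its
-- component of every Gⱼ; as K₁ and K₂ have two vertices each, no xᵢ, yᵢ lies in S. So
-- xᵢyᵢ does not have colour 0 and lies in some hyperedge Lᵢ, and the closed walk
-- x₁ K₁ x₂ L₂ y₂ K₂ y₁ L₁ x₁ in the hyperforest forces K₁ = K₂.
module Submission where

open import Defs hiding (sym)
open import Data.Nat using (ℕ; zero; suc; _≤_; z≤n; s≤s)
open import Data.Nat.Properties using (≤-trans; ≤-reflexive; module ≤-Reasoning)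
open import Data.Fin using (Fin; zero; suc; inject₁; fromℕ; _≟_)
open import Data.Fin.Subset using (Subset; _∈_; _∉_; _∩_; ∣_∣; ⁅_⁆)
open import Data.Fin.Subset.Properties
  using (nonempty?; Empty-unique; ∣⊥∣≡0; x∈⁅x⁆; ∣⁅x⁆∣≡1; p⊆q⇒∣p∣≤∣q∣; x∈p∩q⁻)
open import Data.Bool using (true)
open import Data.Bool.Properties using (T-≡) renaming (_≟_ to _≟ᵇ_)
open import Data.Product using (_×_; _,_; proj₁; proj₂; ∃-syntax)
open import Data.Product.Properties using (≡-dec)
open import Data.Sum using (inj₁; [_,_]′)
open import Data.Empty using (⊥-elim)
open import Data.List using ([]; _∷_)
open import Data.List.Relation.Unary.All using (_∷_)
open import Data.List.Relation.Unary.AllPairs using (_∷_)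
open import Data.Vec using (Vec; []; _∷_; _∷ʳ_; lookup; tabulate; map)
open import Data.Vec.Properties using (lookup∘tabulate; lookup⇒[]=; []=⇒lookup; lookup-map)
  renaming (≡-dec to ≡-decᵛ)
open import Data.Vec.Relation.Unary.All using ([]; _∷_)
open import Data.Vec.Relation.Unary.AllPairs as AllPairs using (AllPairs; []; _∷_)
import Data.Vec.Relation.Unary.AllPairs.Properties as AllPairs
open import Data.Vec.Relation.Unary.Unique.Propositional using (Unique)
open import Data.Vec.Relation.Unary.Unique.Propositional.Properties using (lookup-injective)
open import Data.Vec.Relation.Binary.Pointwise.Inductive as Pointwise
  using (Pointwise; []; _∷_)
open import Function using (_∘_)
open import Function.Bundles using (Equivalence)
open import Level using (0ℓ)
open import Relation.Unary using (Pred; Decidable)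
open import Relation.Nullary using (¬_; Dec; yes; no; does; map′)
open import Relation.Nullary.Decidable
  using (dec-true; decidable-stable; toWitness; isYes; isYes≗does; ¬¬-excluded-middle)
open import Relation.Nullary.Negation using (¬¬-map)
open import Relation.Binary.PropositionalEquality
  using (_≡_; _≢_; refl; sym; trans; cong; subst; ≢-sym; module ≡-Reasoning)
open import Relation.Binary.Construct.Closure.ReflexiveTransitive
  using (Star; ε; _◅_; _◅◅_; reverse)

lookup-∷ʳ-inject₁ : ∀ {a} {A : Set a} {n} (xs : Vec A n) x i →
  lookup (xs ∷ʳ x) (inject₁ i) ≡ lookup xs i
lookup-∷ʳ-inject₁ (_ ∷ _)  _ zero    = refl
lookup-∷ʳ-inject₁ (_ ∷ xs) x (suc i) = lookup-∷ʳ-inject₁ xs x i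

lookup-∷ʳ-fromℕ : ∀ {a} {A : Set a} {n} (xs : Vec A n) x → lookup (xs ∷ʳ x) (fromℕ n) ≡ x
lookup-∷ʳ-fromℕ []       _ = refl
lookup-∷ʳ-fromℕ (_ ∷ xs) x = lookup-∷ʳ-fromℕ xs x

∣p∣≤1 : ∀ {n} {p : Subset n} → (∀ {x y} → x ∈ p → y ∈ p → x ≡ y) → ∣ p ∣ ≤ 1
∣p∣≤1 {n} {p} subsingleton with nonempty? p
... | yes (x , x∈p) = begin
  ∣ p ∣     ≤⟨ p⊆q⇒∣p∣≤∣q∣ (λ y∈p → subst (_∈ ⁅ x ⁆) (subsingleton x∈p y∈p) (x∈⁅x⁆ x)) ⟩
  ∣ ⁅ x ⁆ ∣ ≡⟨ ∣⁅x⁆∣≡1 x ⟩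
  1         ∎
  where open ≤-Reasoning
... | no p-empty = ≤-trans (≤-reflexive (trans (cong ∣_∣ (Empty-unique p-empty)) (∣⊥∣≡0 n))) z≤n

module _ {n} {P : Pred (Fin n) 0ℓ} (P? : Decidable P) where

  subsetOf : Subset n
  subsetOf = tabulate (does ∘ P?)

  ∈-subsetOf⁺ : ∀ {u} → P u → u ∈ subsetOf
  ∈-subsetOf⁺ {u} Pu = lookup⇒[]= u _ (trans (lookup∘tabulate _ u) (dec-true (P? u) Pu))

  ∈-subsetOf⁻ : ∀ {u} → u ∈ subsetOf → P u
  ∈-subsetOf⁻ {u} u∈ = toWitness (Equivalence.from T-≡ (begin
    isYes (P? u)         ≡⟨ isYes≗does (P? u) ⟩
    does (P? u)          ≡⟨ lookup∘tabulate _ u ⟨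
    lookup subsetOf u    ≡⟨ []=⇒lookup u∈ ⟩
    true                 ∎))
    where open ≡-Reasoning

¬¬-decidable : ∀ {n} (P : Pred (Fin n) 0ℓ) → ¬ ¬ Decidable P
¬¬-decidable {zero} P ¬P? = ¬P? λ ()
¬¬-decidable {suc n} P ¬P? =
  ¬¬-excluded-middle λ P₀? → ¬¬-decidable (λ u → P (suc u)) λ Pₛ? →
  ¬P? λ { zero → P₀? ; (suc u) → Pₛ? u }

module _ {n} (H : SimpleGraph n) where

  -- Adj H is an arbitrary relation, so reachability is not decidable and the
  -- vertex set of a component exists only up to double negation.
  ¬¬-component : ∀ x → ¬ ¬ (∃[ K ] IsComponent H K × (∀ {u} → Star (Adj H) x u → u ∈ K))
  ¬¬-component x = ¬¬-map component (¬¬-decidable (Star (Adj H) x))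
    where
    component : Decidable (Star (Adj H) x) →
      ∃[ K ] IsComponent H K × (∀ {u} → Star (Adj H) x u → u ∈ K)
    component reach? =
      subsetOf reach? , (x , λ _ → ∈-subsetOf⁻ reach? , ∈-subsetOf⁺ reach?) , ∈-subsetOf⁺ reach?

  path-from-isolated : ∀ {a b} → (∀ {w} → ¬ Adj H a w) → Star (Adj H) a b → a ≡ b
  path-from-isolated _        ε         = refl
  path-from-isolated isolated (a~w ◅ _) = ⊥-elim (isolated a~w)

  isolated-component : ∀ {a b K} → (∀ {w} → ¬ Adj H a w) →
    IsComponent H K → a ∈ K → b ∈ K → a ≡ b
  isolated-component isolated (_ , K≡reach) a∈K b∈K = path-from-isolated isolated
    (reverse (SimpleGraph.sym H) (proj₁ (K≡reach _) a∈K) ◅◅ proj₁ (K≡reach _) b∈K)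

module Hypergraph {n q} (𝒢 : Colouring n q) where

  infix 4 _∈ₑ_ _≈_ _≈?_

  _∈ₑ_ : Fin n → CEdge 𝒢 → Set
  v ∈ₑ E = v ∈ verts 𝒢 E

  -- A record rather than plain key equality, so that E and F can be inferred.
  record _≈_ (E F : CEdge 𝒢) : Set where
    constructor ≈-key
    field key-≡ : key 𝒢 E ≡ key 𝒢 F

  _≈?_ : ∀ E F → Dec (E ≈ F)
  E ≈? F = map′ ≈-key _≈_.key-≡ (≡-dec _≟_ (≡-decᵛ _≟ᵇ_) (key 𝒢 E) (key 𝒢 F))

  ≈-sym : ∀ {E F} → E ≈ F → F ≈ E
  ≈-sym (≈-key E≡F) = ≈-key (sym E≡F)

  ∈ₑ-resp-≈ : ∀ {v E F} → E ≈ F → v ∈ₑ E → v ∈ₑ F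
  ∈ₑ-resp-≈ {v} (≈-key E≡F) = subst (v ∈_) (cong proj₂ E≡F)

  cycle : ∀ {m} v (vs : Vec (Fin n) (suc m)) (Es : Vec (CEdge 𝒢) (suc (suc m))) →
    Unique (v ∷ vs) → AllPairs (λ E F → ¬ E ≈ F) Es →
    Pointwise _∈ₑ_ (v ∷ vs) Es → Pointwise _∈ₑ_ (vs ∷ʳ v) Es → IncidenceCycle 𝒢
  cycle {m} v vs Es vs-unique Es-distinct here next = record
    { m      = suc m
    ; m≥1    = s≤s z≤n
    ; vs     = lookup (v ∷ vs)
    ; Ks     = lookup Es
    ; vs-inj = lookup-injective vs-unique _ _
    ; Ks-inj = λ i j Eᵢ≡Eⱼ → lookup-injective keys-unique i j (begin
        lookup (map (key 𝒢) Es) i ≡⟨ lookup-map i (key 𝒢) Es ⟩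
        key 𝒢 (lookup Es i)       ≡⟨ Eᵢ≡Eⱼ ⟩
        key 𝒢 (lookup Es j)       ≡⟨ lookup-map j (key 𝒢) Es ⟨
        lookup (map (key 𝒢) Es) j ∎)
    ; inc₁   = Pointwise.lookup here
    ; inc₂   = λ i → subst (_∈ₑ lookup Es (inject₁ i)) (lookup-∷ʳ-inject₁ vs v i)
                       (Pointwise.lookup next (inject₁ i))
    ; close  = subst (_∈ₑ lookup Es (fromℕ (suc m))) (lookup-∷ʳ-fromℕ vs v)
                 (Pointwise.lookup next (fromℕ (suc m)))
    }
    where
    open ≡-Reasoning
    keys-unique : Unique (map (key 𝒢) Es)
    keys-unique = AllPairs.map⁺ (AllPairs.map (λ E≉F → E≉F ∘ ≈-key) Es-distinct)

  module Hyperforest (acyclic : Acyclic 𝒢) where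

    shared-pair⇒≈ : ∀ {a b} E F → a ≢ b → a ∈ₑ E → b ∈ₑ E → a ∈ₑ F → b ∈ₑ F → E ≈ F
    shared-pair⇒≈ {a} {b} E F a≢b aE bE aF bF = decidable-stable (E ≈? F) λ E≉F →
      acyclic (cycle a (b ∷ []) (E ∷ F ∷ [])
        ((a≢b ∷ []) ∷ [] ∷ []) ((E≉F ∷ []) ∷ [] ∷ [])
        (aE ∷ bF ∷ []) (bE ∷ aF ∷ []))

    ∣∩∣≤1 : ∀ {E F} → ¬ E ≈ F → ∣ verts 𝒢 E ∩ verts 𝒢 F ∣ ≤ 1
    ∣∩∣≤1 {E} {F} E≉F = ∣p∣≤1 λ {a} {b} a∈ b∈ → decidable-stable (a ≟ b) λ a≢b →
      let aE , aF = x∈p∩q⁻ (verts 𝒢 E) (verts 𝒢 F) a∈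
          bE , bF = x∈p∩q⁻ (verts 𝒢 E) (verts 𝒢 F) b∈
      in E≉F (shared-pair⇒≈ E F a≢b aE bE aF bF)

    triangle⇒≈ : ∀ {a b c} E F H → a ≢ b → a ≢ c → b ≢ c →
      a ∈ₑ E → b ∈ₑ E → b ∈ₑ F → c ∈ₑ F → c ∈ₑ H → a ∈ₑ H → E ≈ F
    triangle⇒≈ {a} {b} {c} E F H a≢b a≢c b≢c aE bE bF cF cH aH
      with E ≈? F | E ≈? H | F ≈? H
    ... | yes E≈F | _       | _       = E≈F
    ... | _       | yes E≈H | _       = shared-pair⇒≈ E F b≢c bE (∈ₑ-resp-≈ (≈-sym E≈H) cH) bF cF
    ... | _       | _       | yes F≈H = shared-pair⇒≈ E F a≢b aE bE (∈ₑ-resp-≈ (≈-sym F≈H) aH) bF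
    ... | no E≉F  | no E≉H  | no F≉H  = ⊥-elim
      (acyclic (cycle a (b ∷ c ∷ []) (E ∷ F ∷ H ∷ [])
        ((a≢b ∷ a≢c ∷ []) ∷ (b≢c ∷ []) ∷ [] ∷ []) ((E≉F ∷ E≉H ∷ []) ∷ (F≉H ∷ []) ∷ [] ∷ [])
        (aE ∷ bF ∷ cH ∷ []) (bE ∷ cF ∷ aH ∷ [])))

    -- x₁ K₁ x₂ L₂ y₂ K₂ y₁ L₁ x₁ is a closed walk; whenever some L coincides with
    -- some K it shortcuts to a triangle, and otherwise it is a 4-cycle.
    alternating-square⇒≈ : ∀ {x₁ y₁ x₂ y₂} K₁ K₂ L₁ L₂ →
      x₁ ≢ y₁ → x₁ ≢ x₂ → x₁ ≢ y₂ → y₁ ≢ x₂ → y₁ ≢ y₂ → x₂ ≢ y₂ →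
      x₁ ∈ₑ K₁ → x₂ ∈ₑ K₁ → y₁ ∈ₑ K₂ → y₂ ∈ₑ K₂ →
      x₁ ∈ₑ L₁ → y₁ ∈ₑ L₁ → x₂ ∈ₑ L₂ → y₂ ∈ₑ L₂ → K₁ ≈ K₂
    alternating-square⇒≈ {x₁} {y₁} {x₂} {y₂} K₁ K₂ L₁ L₂
      x₁≢y₁ x₁≢x₂ x₁≢y₂ y₁≢x₂ y₁≢y₂ x₂≢y₂ x₁K₁ x₂K₁ y₁K₂ y₂K₂ x₁L₁ y₁L₁ x₂L₂ y₂L₂
      with L₁ ≈? K₁ | L₁ ≈? K₂ | L₂ ≈? K₁ | L₂ ≈? K₂
    ... | yes L₁≈K₁ | _ | _ | _ = triangle⇒≈ K₁ K₂ L₂ (≢-sym y₁≢x₂) x₂≢y₂ y₁≢y₂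
      x₂K₁ (∈ₑ-resp-≈ L₁≈K₁ y₁L₁) y₁K₂ y₂K₂ y₂L₂ x₂L₂
    ... | _ | yes L₁≈K₂ | _ | _ = triangle⇒≈ K₁ K₂ L₂ (≢-sym x₁≢x₂) x₂≢y₂ x₁≢y₂
      x₂K₁ x₁K₁ (∈ₑ-resp-≈ L₁≈K₂ x₁L₁) y₂K₂ y₂L₂ x₂L₂
    ... | _ | _ | yes L₂≈K₁ | _ = triangle⇒≈ K₁ K₂ L₁ x₁≢y₂ x₁≢y₁ (≢-sym y₁≢y₂)
      x₁K₁ (∈ₑ-resp-≈ L₂≈K₁ y₂L₂) y₂K₂ y₁K₂ y₁L₁ x₁L₁
    ... | _ | _ | _ | yes L₂≈K₂ = triangle⇒≈ K₁ K₂ L₁ x₁≢x₂ x₁≢y₁ (≢-sym y₁≢x₂)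
      x₁K₁ x₂K₁ (∈ₑ-resp-≈ L₂≈K₂ x₂L₂) y₁K₂ y₁L₁ x₁L₁
    ... | no L₁≉K₁ | no L₁≉K₂ | no L₂≉K₁ | no L₂≉K₂ = decidable-stable (K₁ ≈? K₂) λ K₁≉K₂ →
      acyclic (cycle x₁ (x₂ ∷ y₂ ∷ y₁ ∷ []) (K₁ ∷ L₂ ∷ K₂ ∷ L₁ ∷ [])
        ((x₁≢x₂ ∷ x₁≢y₂ ∷ x₁≢y₁ ∷ []) ∷ (x₂≢y₂ ∷ ≢-sym y₁≢x₂ ∷ []) ∷
         (≢-sym y₁≢y₂ ∷ []) ∷ [] ∷ [])
        ((L₂≉K₁ ∘ ≈-sym ∷ K₁≉K₂ ∷ L₁≉K₁ ∘ ≈-sym ∷ []) ∷ (L₂≉K₂ ∷ L₂≉L₁ ∷ []) ∷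
         (L₁≉K₂ ∘ ≈-sym ∷ []) ∷ [] ∷ [])
        (x₁K₁ ∷ x₂L₂ ∷ y₂K₂ ∷ y₁L₁ ∷ []) (x₂K₁ ∷ y₂L₂ ∷ y₁K₂ ∷ x₁L₁ ∷ []))
      where
      L₂≉L₁ : ¬ L₂ ≈ L₁
      L₂≉L₁ L₂≈L₁ = L₁≉K₁ (≈-sym (shared-pair⇒≈ K₁ L₁ x₁≢x₂ x₁K₁ x₂K₁ x₁L₁ (∈ₑ-resp-≈ L₂≈L₁ x₂L₂)))

module ProperColouring {n q} (G : SimpleGraph n) (𝒢 : Colouring n q)
  (colouring : IsColouring G 𝒢) (S : Subset n) (proper : SProper G 𝒢 S) where

  open Hypergraph 𝒢

  no-positive-edge-at-S : ∀ {a w} j → a ∈ S → ¬ Adj (𝒢 (suc j)) a w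
  no-positive-edge-at-S {a} {w} j a∈S a~w = proj₂ proper j a w
    (proj₂ (proj₁ proper a w) (proj₂ (colouring a w) (suc j) a~w , inj₁ a∈S)) a~w

  nontrivial⇒∉S : ∀ {a b} E → a ∈ₑ E → b ∈ₑ E → a ≢ b → a ∉ S
  nontrivial⇒∉S (j , K , K-component) a∈K b∈K a≢b a∈S =
    a≢b (isolated-component (𝒢 (suc j)) (no-positive-edge-at-S j a∈S) K-component a∈K b∈K)

  positive-colour : ∀ {x y} → Adj G x y → x ∉ S → y ∉ S → ∃[ j ] Adj (𝒢 (suc j)) x y
  positive-colour {x} {y} x~y x∉S y∉S with proj₁ (colouring x y) x~y
  ... | suc j , x~ⱼy = j , x~ⱼy
  ... | zero  , x~₀y = ⊥-elim ([ x∉S , y∉S ]′ (proj₂ (proj₁ (proj₁ proper x y) x~₀y)))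

  ¬¬-hyperedge-through : ∀ {x y} → Adj G x y → x ∉ S → y ∉ S → ¬ ¬ (∃[ L ] x ∈ₑ L × y ∈ₑ L)
  ¬¬-hyperedge-through {x} x~y x∉S y∉S with positive-colour x~y x∉S y∉S
  ... | j , x~ⱼy = ¬¬-map
    (λ (K , K-component , reach⊆K) → (j , K , K-component) , reach⊆K ε , reach⊆K (x~ⱼy ◅ ε))
    (¬¬-component (𝒢 (suc j)) x)

  matched-pair⇒≈ : Acyclic 𝒢 → ∀ K₁ K₂ {x₁ y₁ x₂ y₂} →
    x₁ ≢ y₁ → x₁ ≢ x₂ → x₁ ≢ y₂ → y₁ ≢ x₂ → y₁ ≢ y₂ → x₂ ≢ y₂ →
    x₁ ∈ₑ K₁ → x₂ ∈ₑ K₁ → y₁ ∈ₑ K₂ → y₂ ∈ₑ K₂ → Adj G x₁ y₁ → Adj G x₂ y₂ → K₁ ≈ K₂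
  matched-pair⇒≈ acyclic K₁ K₂ {x₁} {y₁} {x₂} {y₂} x₁≢y₁ x₁≢x₂ x₁≢y₂ y₁≢x₂ y₁≢y₂ x₂≢y₂
    x₁K₁ x₂K₁ y₁K₂ y₂K₂ x₁~y₁ x₂~y₂ =
    decidable-stable (K₁ ≈? K₂) λ K₁≉K₂ →
    ¬¬-hyperedge-through x₁~y₁ x₁∉S y₁∉S λ (L₁ , x₁L₁ , y₁L₁) →
    ¬¬-hyperedge-through x₂~y₂ x₂∉S y₂∉S λ (L₂ , x₂L₂ , y₂L₂) →
    K₁≉K₂ (Hyperforest.alternating-square⇒≈ acyclic K₁ K₂ L₁ L₂
      x₁≢y₁ x₁≢x₂ x₁≢y₂ y₁≢x₂ y₁≢y₂ x₂≢y₂ x₁K₁ x₂K₁ y₁K₂ y₂K₂ x₁L₁ y₁L₁ x₂L₂ y₂L₂)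
    where
    x₁∉S : x₁ ∉ S
    x₁∉S = nontrivial⇒∉S K₁ x₁K₁ x₂K₁ x₁≢x₂
    x₂∉S : x₂ ∉ S
    x₂∉S = nontrivial⇒∉S K₁ x₂K₁ x₁K₁ (≢-sym x₁≢x₂)
    y₁∉S : y₁ ∉ S
    y₁∉S = nontrivial⇒∉S K₂ y₁K₂ y₂K₂ y₁≢y₂
    y₂∉S : y₂ ∉ S
    y₂∉S = nontrivial⇒∉S K₂ y₂K₂ y₁K₂ (≢-sym y₁≢y₂)

  ν≤1 : Acyclic 𝒢 → ∀ {K₁ K₂} → ¬ K₁ ≈ K₂ → ν≤ G (verts 𝒢 K₁) (verts 𝒢 K₂) 1
  ν≤1 _ _ []       _ = z≤n
  ν≤1 _ _ (_ ∷ []) _ = s≤s z≤n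
  ν≤1 acyclic {K₁} {K₂} K₁≉K₂ (_ ∷ _ ∷ _)
    ((x₁K₁ , y₁K₂ , x₁~y₁) ∷ (x₂K₁ , y₂K₂ , x₂~y₂) ∷ _ ,
     (x₁≢y₁ ∷ x₁≢x₂ ∷ x₁≢y₂ ∷ _) ∷ (y₁≢x₂ ∷ y₁≢y₂ ∷ _) ∷ (x₂≢y₂ ∷ _) ∷ _) =
    ⊥-elim (K₁≉K₂ (matched-pair⇒≈ acyclic K₁ K₂ x₁≢y₁ x₁≢x₂ x₁≢y₂ y₁≢x₂ y₁≢y₂ x₂≢y₂
      x₁K₁ x₂K₁ y₁K₂ y₂K₂ x₁~y₁ x₂~y₂))

lemma3p3 : {n q : ℕ} (G : SimpleGraph n) (𝒢 : Colouring n q) →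
    IsColouring G 𝒢 → Proper G 𝒢 → Acyclic 𝒢 →
    (K₁ K₂ : CEdge 𝒢) → key 𝒢 K₁ ≢ key 𝒢 K₂ →
    ∣ verts 𝒢 K₁ ∩ verts 𝒢 K₂ ∣ ≤ 1 × ν≤ G (verts 𝒢 K₁) (verts 𝒢 K₂) 1
lemma3p3 G 𝒢 colouring (S , proper) acyclic K₁ K₂ K₁≢K₂ =
    Hyperforest.∣∩∣≤1 acyclic K₁≉K₂
  , ProperColouring.ν≤1 G 𝒢 colouring S proper acyclic K₁≉K₂
  where
  open Hypergraph 𝒢
  K₁≉K₂ : ¬ K₁ ≈ K₂
  K₁≉K₂ = K₁≢K₂ ∘ _≈_.key-≡
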